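{- Let $p$ be a prime with $p\equiv 3\pmod 4$ and $p\ge7$. Then there exists a tight $\mathrm{PTE}_p$ solution of degree $2$ for the binary sphere $\Omega=S_{(p-1)/2}^{p-1}$.
   Context: The binary sphere is $S_k^{r-1}=\{(x_1,\ldots,x_r)\in\{0,1\}^r:\sum x_i^2=k\}$. For multisets $A=\{\mathbf{a}_1,\ldots,\mathbf{a}_n\}$, $B=\{\mathbf{b}_1,\ldots,\mathbf{b}_n\}\subset\mathbb{Q}^r$ with $\mathbf{a}_i=(a_{i1},\ldots,a_{ir})$, $\mathbf{b}_i=(b_{i1},\ldots,b_{ir})$, $(A,B)$ is a $\mathrm{PTE}_r$ solution of degree $m$ and size $n$ if $A,B$ have no common element and $\sum_i\prod_j a_{ij}^{k_j}=\sum_i\prod_j b_{ij}^{k_j}$ for all nonnegative integers $k_j$ with $1\le\sum_j k_j\le m$. For $\Omega\subseteq\mathbb{Q}^r$, $\mathcal{P}_t(\Omega)$ is the $\mathbb{Q}$-space of restrictions to $\Omega$ of rational polynomials of degree $\le t$; given a basis $\mathbf{t}_1,\ldots,\mathbf{t}_d$ of it, $N_A=(\mathbf{t}_i(\mathbf{a}_j))$ and $N_B=(\mathbf{t}_i(\mathbf{b}_j))$. A $\mathrm{PTE}_r$ solution $(A,B)$ with $A,B\subseteq\Omega$ of degree $2t$ and size $n$ is tight (for $\Omega$) if $n=\operatorname{rank}[N_A\;N_B]=\dim_{\mathbb{Q}}\mathcal{P}_t(\Omega)$. -}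

module Defs where

open import Data.Nat as ℕ using (ℕ; zero; suc; _≤_)
open import Data.Integer using (+_)
open import Data.Fin using (Fin; zero; suc)
open import Data.Sum using (_⊎_; [_,_])
open import Data.Product using (Σ; _×_; ∃; ∃-syntax; _,_; proj₂)
open import Data.List using (List; []; _∷_)
open import Data.List.Relation.Unary.All using (All)
open import Data.Rational using (ℚ; 0ℚ; 1ℚ; _+_; _*_; _/_)
open import Relation.Binary.PropositionalEquality using (_≡_)
open import Relation.Nullary using (¬_)
open import Function.Definitions using (Injective)

Pt : ℕ → Set
Pt r = Fin r → ℚ

Σℚ : ∀ {n} → (Fin n → ℚ) → ℚ
Σℚ {zero}  f = 0ℚ
Σℚ {suc n} f = f zero + Σℚ (λ i → f (suc i))

Πℚ : ∀ {n} → (Fin n → ℚ) → ℚ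
Πℚ {zero}  f = 1ℚ
Πℚ {suc n} f = f zero * Πℚ (λ i → f (suc i))

Σℕ : ∀ {n} → (Fin n → ℕ) → ℕ
Σℕ {zero}  f = 0
Σℕ {suc n} f = f zero ℕ.+ Σℕ (λ i → f (suc i))

_^ℚ_ : ℚ → ℕ → ℚ
x ^ℚ zero  = 1ℚ
x ^ℚ suc m = x * (x ^ℚ m)

ℕ→ℚ : ℕ → ℚ
ℕ→ℚ k = (+ k) / 1

monomial : ∀ {r} → (Fin r → ℕ) → Pt r → ℚ
monomial e x = Πℚ (λ j → x j ^ℚ e j)

-- binary sphere S_k^{r-1} = { x ∈ {0,1}^r : Σ x_j^2 = k } (as a predicate on ℚ^r)
BinarySphere : (r k : ℕ) → Pt r → Set
BinarySphere r k x = (∀ j → (x j ≡ 0ℚ) ⊎ (x j ≡ 1ℚ)) × (Σℚ (λ j → x j * x j) ≡ ℕ→ℚ k)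

-- PTE_r solution of degree m and size n: multisets given as indexed families
IsPTE : (r m n : ℕ) → (A B : Fin n → Pt r) → Set
IsPTE r m n A B =
  (∀ i j → ¬ (A i ≡ B j))
  × (∀ (e : Fin r → ℕ) → 1 ≤ Σℕ e → Σℕ e ≤ m →
       Σℚ (λ i → monomial e (A i)) ≡ Σℚ (λ i → monomial e (B i)))

Poly : ℕ → Set
Poly r = List (ℚ × (Fin r → ℕ))

evalPoly : ∀ {r} → Poly r → Pt r → ℚ
evalPoly []             x = 0ℚ
evalPoly ((c , e) ∷ ps) x = c * monomial e x + evalPoly ps x

DegLe : ∀ {r} → ℕ → Poly r → Set
DegLe {r} t p = All (λ (ce : ℚ × (Fin r → ℕ)) → Σℕ (proj₂ ce) ≤ t) p

IsBasisP : (r t : ℕ) (Ω : Pt r → Set) (d : ℕ) → (Fin d → Poly r) → Set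
IsBasisP r t Ω d b =
  (∀ i → DegLe t (b i))
  × (∀ (c : Fin d → ℚ) → (∀ x → Ω x → Σℚ (λ i → c i * evalPoly (b i) x) ≡ 0ℚ) → ∀ i → c i ≡ 0ℚ)
  × (∀ (f : Poly r) → DegLe t f →
       Σ (Fin d → ℚ) λ c → (∀ x → Ω x → evalPoly f x ≡ Σℚ (λ i → c i * evalPoly (b i) x)))

RowsIndep : ∀ {k} {C : Set} → (Fin k → C → ℚ) → Set
RowsIndep {k} {C} M = ∀ (c : Fin k → ℚ) → (∀ (j : C) → Σℚ (λ i → c i * M i j) ≡ 0ℚ) → ∀ i → c i ≡ 0ℚ

HasRank : ∀ {d} {C : Set} → (Fin d → C → ℚ) → ℕ → Set
HasRank {d} M ρ =
  (Σ (Fin ρ → Fin d) λ σ → Injective _≡_ _≡_ σ × RowsIndep (λ (i : Fin ρ) → M (σ i)))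
  × (∀ (σ : Fin (suc ρ) → Fin d) → Injective _≡_ _≡_ σ → ¬ RowsIndep (λ i → M (σ i)))

-- [N_A N_B] : rows indexed by basis elements, columns by A ⊔ B
NANB : ∀ {r d n} → (Fin d → Poly r) → (A B : Fin n → Pt r) → Fin d → (Fin n ⊎ Fin n) → ℚ
NANB b A B i = [ (λ j → evalPoly (b i) (A j)) , (λ j → evalPoly (b i) (B j)) ]

IsTightPTE : (r t : ℕ) (Ω : Pt r → Set) (n : ℕ) (A B : Fin n → Pt r) → Set
IsTightPTE r t Ω n A B =
  (∀ i → Ω (A i)) × (∀ i → Ω (B i)) × IsPTE r (2 ℕ.* t) n A B
  × (∃[ d ] Σ (Fin d → Poly r) λ b → IsBasisP r t Ω d b × (n ≡ d) × HasRank (NANB b A B) d)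

{-# OPTIONS --safe #-}
module Submission where

-- A design of size r and weight w is a pair of families A, B of r points of weight w in {0,1}^r
-- such that every set of at most two coordinates is contained in as many rows of A as of B, and
-- such that A ∪ B affinely spans the hyperplane Σ x = w.  At a 0/1 point a monomial is the
-- indicator of its support, so the first condition is the PTE condition of degree 2.  On the
-- hyperplane (w ≠ 0) the coordinate functions form a basis of P₁, and the second condition makes
-- them independent already on A ∪ B; hence a design is a tight solution with n = rank = r.
--
-- The translates of the quadratic residues and of the non-residues modulo 7 form a design of
-- size 7.  A design of size r extends to one of size r + 4 and weight w + 2: four coordinates
-- are prepended, the old rows get the tags {2,3} (first row) and {0,1} (other rows), and four new
-- rows, the first rows A₀ and B₀ with their empty first coordinate switched on, get the tags
-- {0}, {1} and {2}, {3}; B' is the same construction with A and B exchanged.  Once the old rows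
-- are cancelled by the old moment condition, the new one is an identity in seven bits.  This
-- reaches every p ≡ 3 (mod 4) with p ≥ 7.

open import Defs
open import Data.Nat using (ℕ; _≤_; _∸_)
open import Data.Nat.DivMod using (_%_; _/_)
open import Data.Nat.Primality using (Prime)
open import Data.Fin using (Fin)
open import Data.Product using (Σ; ∃-syntax)
open import Relation.Binary.PropositionalEquality using (_≡_)

open import Algebra.Bundles using (CommutativeMonoid)
open import Data.Bool using (Bool; true; false; not; _∧_; _∨_; _xor_)
import Data.Bool.Properties as Boolₚ
open import Data.Empty using (⊥-elim)
open import Data.Fin using (zero; suc)
open import Data.Fin.Patterns using (0F; 1F; 2F; 3F; 4F; 5F; 6F)
import Data.Fin.Properties as Finₚ
open import Data.Fin.Subset using (Subset; inside; outside; ∣_∣; ⁅_⁆; _∪_; _∩_) renaming (⊥ to ∅)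
open import Data.Fin.Subset.Properties using (anySubset?)
open import Data.Integer as ℤ using () renaming (+_ to pos)
import Data.Integer.Properties as ℤₚ
import Data.List as List
import Data.List.Relation.Unary.All as All
open import Data.Nat as ℕ using (zero; suc; z≤n; s≤s)
open import Data.Nat.Coprimality using (1-coprimeTo) renaming (sym to coprime-sym)
open import Data.Nat.DivMod using (m≡m%n+[m/n]*n; m*n/n≡m)
import Data.Nat.Properties as ℕₚ
open import Data.Nat.Tactic.RingSolver using (solve-∀)
open import Data.Product using (_,_; ∃; proj₁; proj₂)
open import Data.Rational using (ℚ; 0ℚ; 1ℚ; _+_; _*_; mkℚ; 1/_)
import Data.Rational.Properties as ℚₚ
open import Algebra.Properties.CommutativeSemigroup
  (CommutativeMonoid.commutativeSemigroup ℚₚ.+-0-commutativeMonoid)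
  using () renaming (interchange to +-interchange; x∙yz≈y∙xz to +-left-comm)
open import Algebra.Properties.Group ℚₚ.+-0-group using () renaming (∙-cancelˡ to +-cancelˡ)
import Data.Rational.Unnormalised as ℚᵘ
import Data.Rational.Unnormalised.Properties as ℚᵘₚ
open import Data.Sum using (_⊎_; inj₁; inj₂; [_,_])
open import Data.Vec using ([]; _∷_; _++_; lookup; head; tail; tabulate; iterate; init; last)
import Data.Vec.Properties as Vecₚ
open import Function using (_∘_; _$_; id)
open import Relation.Binary.PropositionalEquality
  using (_≢_; refl; sym; trans; cong; cong₂; subst; module ≡-Reasoning)
open import Relation.Nullary using (Dec; ¬?; _×-dec_)
open import Relation.Nullary.Decidable using (map′; from-yes; from-no; decidable-stable; _→-dec_)
open import Relation.Unary using (Decidable)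

ℕ→ℚ≡mkℚ : ∀ n → ℕ→ℚ n ≡ mkℚ (pos n) 0 (coprime-sym (1-coprimeTo n))
ℕ→ℚ≡mkℚ n = ℚₚ.normalize-coprime (coprime-sym (1-coprimeTo n))

ℕ→ℚ-suc : ∀ n → ℕ→ℚ (suc n) ≡ 1ℚ + ℕ→ℚ n
ℕ→ℚ-suc n rewrite ℕ→ℚ≡mkℚ (suc n) | ℕ→ℚ≡mkℚ n =
  ℚₚ.toℚᵘ-injective (ℚᵘₚ.≃-trans (ℚᵘ.*≡* numerators) (ℚᵘₚ.≃-sym (ℚₚ.toℚᵘ-homo-+ 1ℚ n/1)))
  where
  n/1 = mkℚ (pos n) 0 (coprime-sym (1-coprimeTo n))
  numerators : pos (suc n) ℤ.* pos 1 ≡ (pos 1 ℤ.* pos 1 ℤ.+ pos n ℤ.* pos 1) ℤ.* pos 1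
  numerators = trans (ℤₚ.*-identityʳ _)
                     (sym (trans (ℤₚ.*-identityʳ _) (cong (λ z → pos 1 ℤ.+ z) (ℤₚ.*-identityʳ (pos n)))))

Invertible : ℚ → Set
Invertible x = ∃ λ y → y * x ≡ 1ℚ

ℕ→ℚ-suc-invertible : ∀ k → Invertible (ℕ→ℚ (suc k))
ℕ→ℚ-suc-invertible k rewrite ℕ→ℚ≡mkℚ (suc k) = 1/ k+1 , ℚₚ.*-inverseˡ k+1
  where k+1 = mkℚ (pos (suc k)) 0 (coprime-sym (1-coprimeTo (suc k)))

invertible⇒*≡0⇒≡0 : ∀ {x μ} → Invertible x → x * μ ≡ 0ℚ → μ ≡ 0ℚ
invertible⇒*≡0⇒≡0 {x} {μ} (y , yx≡1) xμ≡0 = begin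
  μ             ≡⟨ ℚₚ.*-identityˡ μ ⟨
  1ℚ * μ        ≡⟨ cong (_* μ) yx≡1 ⟨
  (y * x) * μ   ≡⟨ ℚₚ.*-assoc y x μ ⟩
  y * (x * μ)   ≡⟨ cong (y *_) xμ≡0 ⟩
  y * 0ℚ        ≡⟨ ℚₚ.*-zeroʳ y ⟩
  0ℚ            ∎
  where open ≡-Reasoning

cancel-prefix : ∀ {a b x a' b' y l : ℚ} → a + (b + x) ≡ l → a' + (b' + y) ≡ l → a ≡ a' → b ≡ b' → x ≡ y
cancel-prefix {a} {b} h h' refl refl = +-cancelˡ b _ _ (+-cancelˡ a _ _ (trans h (sym h')))

gated-balance : ∀ x y g a b m n → x ℕ.+ g ℕ.* b ≡ y ℕ.+ g ℕ.* a → a ℕ.+ m ≡ b ℕ.+ n →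
                x ℕ.+ g ℕ.* m ≡ y ℕ.+ g ℕ.* n
gated-balance x y g a b m n new old = ℕₚ.+-cancelʳ-≡ (g ℕ.* a ℕ.+ g ℕ.* b) _ _ (begin
  x ℕ.+ g ℕ.* m ℕ.+ (g ℕ.* a ℕ.+ g ℕ.* b)   ≡⟨ regroup x g b a m ⟩
  x ℕ.+ g ℕ.* b ℕ.+ g ℕ.* (a ℕ.+ m)         ≡⟨ cong₂ (λ u v → u ℕ.+ g ℕ.* v) new old ⟩
  y ℕ.+ g ℕ.* a ℕ.+ g ℕ.* (b ℕ.+ n)         ≡⟨ regroup y g a b n ⟨
  y ℕ.+ g ℕ.* n ℕ.+ (g ℕ.* b ℕ.+ g ℕ.* a)   ≡⟨ cong (y ℕ.+ g ℕ.* n ℕ.+_) (ℕₚ.+-comm (g ℕ.* b) (g ℕ.* a)) ⟩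
  y ℕ.+ g ℕ.* n ℕ.+ (g ℕ.* a ℕ.+ g ℕ.* b)   ∎)
  where
  open ≡-Reasoning
  regroup : ∀ x g b a m → x ℕ.+ g ℕ.* m ℕ.+ (g ℕ.* a ℕ.+ g ℕ.* b) ≡ x ℕ.+ g ℕ.* b ℕ.+ g ℕ.* (a ℕ.+ m)
  regroup = solve-∀

bitℕ : Bool → ℕ
bitℕ false = 0
bitℕ true  = 1

bitℚ : Bool → ℚ
bitℚ false = 0ℚ
bitℚ true  = 1ℚ

bitℚ-injective : ∀ {a b} → bitℚ a ≡ bitℚ b → a ≡ b
bitℚ-injective {false} {false} _ = refl
bitℚ-injective {false} {true}  e = ⊥-elim (ℚₚ.1≢0 (sym e))
bitℚ-injective {true}  {false} e = ⊥-elim (ℚₚ.1≢0 e)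
bitℚ-injective {true}  {true}  _ = refl

bitℚ-∧ : ∀ a b → bitℚ a * bitℚ b ≡ bitℚ (a ∧ b)
bitℚ-∧ false b = ℚₚ.*-zeroˡ (bitℚ b)
bitℚ-∧ true  b = ℚₚ.*-identityˡ (bitℚ b)

ℕ→ℚ-bit+ : ∀ b n → ℕ→ℚ (bitℕ b ℕ.+ n) ≡ bitℚ b + ℕ→ℚ n
ℕ→ℚ-bit+ false n = sym (ℚₚ.+-identityˡ (ℕ→ℚ n))
ℕ→ℚ-bit+ true  n = ℕ→ℚ-suc n

Σℚ-cong : ∀ {n} {f g : Fin n → ℚ} → (∀ i → f i ≡ g i) → Σℚ f ≡ Σℚ g
Σℚ-cong {zero}  f≗g = refl
Σℚ-cong {suc n} f≗g = cong₂ _+_ (f≗g zero) (Σℚ-cong (f≗g ∘ suc))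

Σℕ-cong : ∀ {n} {f g : Fin n → ℕ} → (∀ i → f i ≡ g i) → Σℕ f ≡ Σℕ g
Σℕ-cong {zero}  f≗g = refl
Σℕ-cong {suc n} f≗g = cong₂ ℕ._+_ (f≗g zero) (Σℕ-cong (f≗g ∘ suc))

Σℕ-zero : ∀ n → Σℕ {n} (λ _ → 0) ≡ 0
Σℕ-zero zero    = refl
Σℕ-zero (suc n) = Σℕ-zero n

count : ∀ {n} → (Fin n → Bool) → ℕ
count P = Σℕ (bitℕ ∘ P)

count-cong : ∀ {n} {P Q : Fin n → Bool} → (∀ i → P i ≡ Q i) → count P ≡ count Q
count-cong P≗Q = Σℕ-cong (cong bitℕ ∘ P≗Q)

count-∧ : ∀ {n} b (P : Fin n → Bool) → count (λ i → b ∧ P i) ≡ bitℕ b ℕ.* count P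
count-∧ {n} false P = Σℕ-zero n
count-∧     true  P = sym (ℕₚ.+-identityʳ (count P))

Σℚ-bitℚ : ∀ {n} (P : Fin n → Bool) → Σℚ (bitℚ ∘ P) ≡ ℕ→ℚ (count P)
Σℚ-bitℚ {zero}  P = refl
Σℚ-bitℚ {suc n} P = trans (cong (bitℚ (P zero) +_) (Σℚ-bitℚ (P ∘ suc))) (sym (ℕ→ℚ-bit+ (P zero) _))

all-bools? : ∀ {P : Bool → Set} → Decidable P → Dec (∀ b → P b)
all-bools? P? = map′ (λ (P₀ , P₁) → λ { false → P₀ ; true → P₁ }) (λ ∀P → ∀P false , ∀P true)
                     (P? false ×-dec P? true)

all-subsets? : ∀ {n} {P : Subset n → Set} → Decidable P → Dec (∀ s → P s)
all-subsets? P? = map′ (λ ∄¬P s → decidable-stable (P? s) (∄¬P ∘ (s ,_)))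
                       (λ ∀P (s , ¬Ps) → ¬Ps (∀P s))
                       (¬? (anySubset? (¬? ∘ P?)))

-- Subsets as 0/1 points

point : ∀ {r} → Subset r → Pt r
point v j = bitℚ (lookup v j)

point-injective : ∀ {r} {u v : Subset r} → point u ≡ point v → u ≡ v
point-injective {u = u} {v} eq = begin
  u                   ≡⟨ Vecₚ.tabulate∘lookup u ⟨
  tabulate (lookup u) ≡⟨ Vecₚ.tabulate-cong (λ j → bitℚ-injective (cong (_$ j) eq)) ⟩
  tabulate (lookup v) ≡⟨ Vecₚ.tabulate∘lookup v ⟩
  v                   ∎
  where open ≡-Reasoning

∣∷∣ : ∀ {r} x (v : Subset r) → ∣ x ∷ v ∣ ≡ bitℕ x ℕ.+ ∣ v ∣
∣∷∣ false v = refl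
∣∷∣ true  v = refl

∣++∣ : ∀ {m n} (t : Subset m) (u : Subset n) → ∣ t ++ u ∣ ≡ ∣ t ∣ ℕ.+ ∣ u ∣
∣++∣ []            u = refl
∣++∣ (outside ∷ t) u = ∣++∣ t u
∣++∣ (inside ∷ t)  u = cong suc (∣++∣ t u)

≡outside∷tail : ∀ {n} (v : Subset (suc n)) → head v ≡ outside → v ≡ outside ∷ tail v
≡outside∷tail (outside ∷ v) _ = refl

++⁺-≢ : ∀ {m n} (t : Subset m) {u v : Subset n} → u ≢ v → t ++ u ≢ t ++ v
++⁺-≢ t u≢v = u≢v ∘ Vecₚ.++-injectiveʳ t t

Σℚ-point² : ∀ {r} (v : Subset r) → Σℚ (λ j → point v j * point v j) ≡ ℕ→ℚ ∣ v ∣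
Σℚ-point² []      = refl
Σℚ-point² (x ∷ v) = begin
  bitℚ x * bitℚ x + Σℚ (λ j → point v j * point v j)
    ≡⟨ cong₂ _+_ (trans (bitℚ-∧ x x) (cong bitℚ (Boolₚ.∧-idem x))) (Σℚ-point² v) ⟩
  bitℚ x + ℕ→ℚ ∣ v ∣        ≡⟨ ℕ→ℚ-bit+ x ∣ v ∣ ⟨
  ℕ→ℚ (bitℕ x ℕ.+ ∣ v ∣)    ≡⟨ cong ℕ→ℚ (∣∷∣ x v) ⟨
  ℕ→ℚ ∣ x ∷ v ∣             ∎
  where open ≡-Reasoning

point∈BinarySphere : ∀ {r} (v : Subset r) → BinarySphere r ∣ v ∣ (point v)
point∈BinarySphere v = binary , Σℚ-point² v
  where
  binary : ∀ j → (point v j ≡ 0ℚ) ⊎ (point v j ≡ 1ℚ)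
  binary j with lookup v j
  ... | false = inj₁ refl
  ... | true  = inj₂ refl

BinarySphere⇒Σℚ : ∀ {r w} x → BinarySphere r w x → Σℚ x ≡ ℕ→ℚ w
BinarySphere⇒Σℚ x (binary , Σx²≡w) = trans (Σℚ-cong (λ j → sym (idempotent j))) Σx²≡w
  where
  idempotent : ∀ j → x j * x j ≡ x j
  idempotent j with binary j
  ... | inj₁ xⱼ≡0 rewrite xⱼ≡0 = refl
  ... | inj₂ xⱼ≡1 rewrite xⱼ≡1 = refl

-- The bit of v is tested first, so that s ⊆ᵇ v computes whenever the row v is known.
infix 5 _⊆ᵇ_
_⊆ᵇ_ : ∀ {r} → Subset r → Subset r → Bool
[]      ⊆ᵇ []      = true
(s ∷ t) ⊆ᵇ (x ∷ v) = (x ∨ not s) ∧ (t ⊆ᵇ v)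

⊆ᵇ-++ : ∀ {m n} (t : Subset m) (u : Subset n) x y → (t ++ u) ⊆ᵇ (x ++ y) ≡ (t ⊆ᵇ x) ∧ (u ⊆ᵇ y)
⊆ᵇ-++ []      u []       y = refl
⊆ᵇ-++ (s ∷ t) u (x ∷ xs) y =
  trans (cong ((x ∨ not s) ∧_) (⊆ᵇ-++ t u xs y)) (sym (Boolₚ.∧-assoc (x ∨ not s) (t ⊆ᵇ xs) (u ⊆ᵇ y)))

⊆ᵇ-xor≤ : ∀ {n} (s u v : Subset n) → bitℕ ((s ⊆ᵇ u) xor (s ⊆ᵇ v)) ≤ ∣ s ∣
⊆ᵇ-xor≤ []            []      []      = z≤n
⊆ᵇ-xor≤ (inside ∷ s)  u       v       = bit≤1+ (((inside ∷ s) ⊆ᵇ u) xor ((inside ∷ s) ⊆ᵇ v))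
  where
  bit≤1+ : ∀ b → bitℕ b ≤ suc ∣ s ∣
  bit≤1+ false = z≤n
  bit≤1+ true  = s≤s z≤n
⊆ᵇ-xor≤ (outside ∷ s) (x ∷ u) (y ∷ v) rewrite Boolₚ.∨-zeroʳ x | Boolₚ.∨-zeroʳ y = ⊆ᵇ-xor≤ s u v

positive : ℕ → Bool
positive zero    = false
positive (suc _) = true

support : ∀ {r} → (Fin r → ℕ) → Subset r
support e = tabulate (positive ∘ e)

∣support∣≤Σℕ : ∀ {r} (e : Fin r → ℕ) → ∣ support e ∣ ≤ Σℕ e
∣support∣≤Σℕ {zero}  e = z≤n
∣support∣≤Σℕ {suc r} e =
  ℕₚ.≤-trans (ℕₚ.≤-reflexive (∣∷∣ (positive (e zero)) (support (e ∘ suc))))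
             (ℕₚ.+-mono-≤ (bit≤ (e zero)) (∣support∣≤Σℕ (e ∘ suc)))
  where
  bit≤ : ∀ n → bitℕ (positive n) ≤ n
  bit≤ zero    = z≤n
  bit≤ (suc n) = s≤s z≤n

bitℚ-^ : ∀ x n → bitℚ x ^ℚ n ≡ bitℚ (x ∨ not (positive n))
bitℚ-^ false zero    = refl
bitℚ-^ true  zero    = refl
bitℚ-^ false (suc n) = ℚₚ.*-zeroˡ (0ℚ ^ℚ n)
bitℚ-^ true  (suc n) = trans (ℚₚ.*-identityˡ (1ℚ ^ℚ n)) (bitℚ-^ true n)

monomial-point : ∀ {r} (e : Fin r → ℕ) (v : Subset r) → monomial e (point v) ≡ bitℚ (support e ⊆ᵇ v)
monomial-point e []      = refl
monomial-point e (x ∷ v) =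
  trans (cong₂ _*_ (bitℚ-^ x (e zero)) (monomial-point (e ∘ suc) v))
        (bitℚ-∧ (x ∨ not (positive (e zero))) (support (e ∘ suc) ⊆ᵇ v))

linear : ∀ {r} → (Fin r → ℚ) → Pt r → ℚ
linear c x = Σℚ (λ i → c i * x i)

infix 7 _·_
_·_ : ∀ {r} → (Fin r → ℚ) → Subset r → ℚ
c · []            = 0ℚ
c · (inside ∷ v)  = c zero + (c ∘ suc) · v
c · (outside ∷ v) = (c ∘ suc) · v

linear-point : ∀ {r} (c : Fin r → ℚ) (v : Subset r) → linear c (point v) ≡ c · v
linear-point c []            = refl
linear-point c (inside ∷ v)  = cong₂ _+_ (ℚₚ.*-identityʳ (c zero)) (linear-point (c ∘ suc) v)
linear-point c (outside ∷ v) =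
  trans (cong₂ _+_ (ℚₚ.*-zeroʳ (c zero)) (linear-point (c ∘ suc) v)) (ℚₚ.+-identityˡ _)

·-constant : ∀ {r} {c : Fin r → ℚ} {μ} → (∀ j → c j ≡ μ) → ∀ v → c · v ≡ ℕ→ℚ ∣ v ∣ * μ
·-constant         {μ = μ} c≡μ []            = sym (ℚₚ.*-zeroˡ μ)
·-constant                 c≡μ (outside ∷ v) = ·-constant (c≡μ ∘ suc) v
·-constant {c = c} {μ}     c≡μ (inside ∷ v)  = begin
  c zero + (c ∘ suc) · v ≡⟨ cong₂ _+_ (c≡μ zero) (·-constant (c≡μ ∘ suc) v) ⟩
  μ + ℕ→ℚ ∣ v ∣ * μ      ≡⟨ cong (_+ ℕ→ℚ ∣ v ∣ * μ) (ℚₚ.*-identityˡ μ) ⟨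
  1ℚ * μ + ℕ→ℚ ∣ v ∣ * μ ≡⟨ ℚₚ.*-distribʳ-+ μ 1ℚ (ℕ→ℚ ∣ v ∣) ⟨
  (1ℚ + ℕ→ℚ ∣ v ∣) * μ   ≡⟨ cong (_* μ) (ℕ→ℚ-suc ∣ v ∣) ⟨
  ℕ→ℚ (suc ∣ v ∣) * μ    ∎
  where open ≡-Reasoning

·-∪-∩ : ∀ {r} (c : Fin r → ℚ) (u v : Subset r) → c · u + c · v ≡ c · (u ∪ v) + c · (u ∩ v)
·-∪-∩ c []            []            = refl
·-∪-∩ c (outside ∷ u) (outside ∷ v) = ·-∪-∩ (c ∘ suc) u v
·-∪-∩ c (inside ∷ u)  (outside ∷ v) =
  trans (ℚₚ.+-assoc (c zero) _ _)
        (trans (cong (c zero +_) (·-∪-∩ (c ∘ suc) u v)) (sym (ℚₚ.+-assoc (c zero) _ _)))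
·-∪-∩ c (outside ∷ u) (inside ∷ v)  =
  trans (+-left-comm ((c ∘ suc) · u) (c zero) ((c ∘ suc) · v))
        (trans (cong (c zero +_) (·-∪-∩ (c ∘ suc) u v)) (sym (ℚₚ.+-assoc (c zero) _ _)))
·-∪-∩ c (inside ∷ u)  (inside ∷ v)  =
  trans (+-interchange (c zero) _ (c zero) _)
        (trans (cong (c zero + c zero +_) (·-∪-∩ (c ∘ suc) u v)) (+-interchange (c zero) (c zero) _ _))

·-∅ : ∀ {r} (c : Fin r → ℚ) → c · ∅ ≡ 0ℚ
·-∅ {zero}  c = refl
·-∅ {suc r} c = ·-∅ (c ∘ suc)

·-⁅⁆ : ∀ {r} (c : Fin r → ℚ) j → c · ⁅ j ⁆ ≡ c j
·-⁅⁆ c zero    = trans (cong (c zero +_) (·-∅ (c ∘ suc))) (ℚₚ.+-identityʳ (c zero))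
·-⁅⁆ c (suc j) = ·-⁅⁆ (c ∘ suc) j

·-exchange : ∀ {r} (c : Fin r → ℚ) {u v : Subset r} {a b} →
             u ∪ ⁅ a ⁆ ≡ v ∪ ⁅ b ⁆ → u ∩ ⁅ a ⁆ ≡ v ∩ ⁅ b ⁆ → c · u ≡ c · v → c a ≡ c b
·-exchange c {u} {v} {a} {b} ∪≡ ∩≡ cu≡cv = +-cancelˡ (c · u) (c a) (c b) (begin
  c · u + c a                         ≡⟨ cong (c · u +_) (·-⁅⁆ c a) ⟨
  c · u + c · ⁅ a ⁆                   ≡⟨ ·-∪-∩ c u ⁅ a ⁆ ⟩
  c · (u ∪ ⁅ a ⁆) + c · (u ∩ ⁅ a ⁆)   ≡⟨ cong₂ (λ x y → c · x + c · y) ∪≡ ∩≡ ⟩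
  c · (v ∪ ⁅ b ⁆) + c · (v ∩ ⁅ b ⁆)   ≡⟨ ·-∪-∩ c v ⁅ b ⁆ ⟨
  c · v + c · ⁅ b ⁆                   ≡⟨ cong₂ _+_ (sym cu≡cv) (·-⁅⁆ c b) ⟩
  c · u + c b                         ∎)
  where open ≡-Reasoning

single : ∀ {r} → Fin r → ℚ → Fin r → ℚ
single zero    a zero    = a
single zero    a (suc _) = 0ℚ
single (suc j) a zero    = 0ℚ
single (suc j) a (suc i) = single j a i

linear-zero : ∀ {r} (x : Pt r) → linear (λ _ → 0ℚ) x ≡ 0ℚ
linear-zero {zero}  x = refl
linear-zero {suc r} x = trans (cong₂ _+_ (ℚₚ.*-zeroˡ (x zero)) (linear-zero (x ∘ suc))) (ℚₚ.+-identityˡ 0ℚ)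

linear-+ : ∀ {r} (c d : Fin r → ℚ) x → linear (λ i → c i + d i) x ≡ linear c x + linear d x
linear-+ {zero}  c d x = sym (ℚₚ.+-identityˡ 0ℚ)
linear-+ {suc r} c d x = begin
  (c zero + d zero) * x zero + linear (λ i → c (suc i) + d (suc i)) (x ∘ suc)
    ≡⟨ cong₂ _+_ (ℚₚ.*-distribʳ-+ (x zero) (c zero) (d zero)) (linear-+ (c ∘ suc) (d ∘ suc) (x ∘ suc)) ⟩
  (c zero * x zero + d zero * x zero) + (linear (c ∘ suc) (x ∘ suc) + linear (d ∘ suc) (x ∘ suc))
    ≡⟨ +-interchange (c zero * x zero) (d zero * x zero) (linear (c ∘ suc) (x ∘ suc)) (linear (d ∘ suc) (x ∘ suc)) ⟩
  linear c x + linear d x ∎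
  where open ≡-Reasoning

linear-constant : ∀ {r} t (x : Pt r) → linear (λ _ → t) x ≡ t * Σℚ x
linear-constant {zero}  t x = sym (ℚₚ.*-zeroʳ t)
linear-constant {suc r} t x =
  trans (cong (t * x zero +_) (linear-constant t (x ∘ suc))) (sym (ℚₚ.*-distribˡ-+ t _ _))

linear-single : ∀ {r} (j : Fin r) a x → linear (single j a) x ≡ a * x j
linear-single zero    a x = trans (cong (a * x zero +_) (linear-zero (x ∘ suc))) (ℚₚ.+-identityʳ _)
linear-single (suc j) a x =
  trans (cong₂ _+_ (ℚₚ.*-zeroˡ (x zero)) (linear-single j a (x ∘ suc))) (ℚₚ.+-identityˡ _)

-- Polynomials of degree at most one on a hyperplane

δ : ∀ {r} → Fin r → Fin r → ℕ
δ zero    zero    = 1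
δ zero    (suc _) = 0
δ (suc j) zero    = 0
δ (suc j) (suc i) = δ j i

coordinate : ∀ {r} → Fin r → Poly r
coordinate j = List.[ 1ℚ , δ j ]

Σℕ-δ : ∀ {r} (j : Fin r) → Σℕ (δ j) ≡ 1
Σℕ-δ {suc r} zero    = cong suc (Σℕ-zero r)
Σℕ-δ         (suc j) = Σℕ-δ j

Σℕ≡0⇒monomial≡1 : ∀ {r} (e : Fin r → ℕ) x → Σℕ e ≡ 0 → monomial e x ≡ 1ℚ
Σℕ≡0⇒monomial≡1 {zero}  e x _ = refl
Σℕ≡0⇒monomial≡1 {suc r} e x Σe≡0 with e zero | ℕₚ.m+n≡0⇒m≡0 (e zero) Σe≡0 | ℕₚ.m+n≡0⇒n≡0 (e zero) Σe≡0
... | .0 | refl | Σe'≡0 = trans (ℚₚ.*-identityˡ _) (Σℕ≡0⇒monomial≡1 (e ∘ suc) (x ∘ suc) Σe'≡0)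

monomial-δ : ∀ {r} (j : Fin r) x → monomial (δ j) x ≡ x j
monomial-δ {suc r} zero x =
  trans (cong (x zero * 1ℚ *_) (Σℕ≡0⇒monomial≡1 (δ zero ∘ suc) (x ∘ suc) (Σℕ-zero r)))
        (trans (ℚₚ.*-identityʳ _) (ℚₚ.*-identityʳ (x zero)))
monomial-δ (suc j) x = trans (ℚₚ.*-identityˡ _) (monomial-δ j (x ∘ suc))

monomial-degree≤1 : ∀ {r} (e : Fin r → ℕ) → Σℕ e ≤ 1 →
                    (∀ x → monomial e x ≡ 1ℚ) ⊎ ∃ λ j → ∀ x → monomial e x ≡ x j
monomial-degree≤1 {zero}  e _ = inj₁ (λ _ → refl)
monomial-degree≤1 {suc r} e Σe≤1 with e zero
... | zero with monomial-degree≤1 (e ∘ suc) Σe≤1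
...   | inj₁ e'≡1       = inj₁ (λ x → trans (ℚₚ.*-identityˡ _) (e'≡1 (x ∘ suc)))
...   | inj₂ (j , e'≡j) = inj₂ (suc j , λ x → trans (ℚₚ.*-identityˡ _) (e'≡j (x ∘ suc)))
monomial-degree≤1 {suc r} e (s≤s Σe'≤0) | suc zero = inj₂ (zero , λ x →
  trans (cong (x zero * 1ℚ *_) (Σℕ≡0⇒monomial≡1 (e ∘ suc) (x ∘ suc) (ℕₚ.n≤0⇒n≡0 Σe'≤0)))
        (trans (ℚₚ.*-identityʳ _) (ℚₚ.*-identityʳ (x zero))))
monomial-degree≤1 {suc r} e (s≤s ()) | suc (suc _)

evalPoly-coordinates : ∀ {r} (c : Fin r → ℚ) x → Σℚ (λ i → c i * evalPoly (coordinate i) x) ≡ linear c x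
evalPoly-coordinates c x = Σℚ-cong λ i →
  cong (c i *_) (trans (ℚₚ.+-identityʳ _) (trans (ℚₚ.*-identityˡ _) (monomial-δ i x)))

module _ {r : ℕ} {w : ℚ} (w⁻¹ : Invertible w) where

  affine-on-hyperplane : ∀ (f : Poly r) → DegLe 1 f →
    Σ (Fin r → ℚ) λ c → ∀ x → Σℚ x ≡ w → evalPoly f x ≡ linear c x
  affine-on-hyperplane List.[] All.[] = (λ _ → 0ℚ) , λ x _ → sym (linear-zero x)
  affine-on-hyperplane ((a , e) List.∷ f) (Σe≤1 All.∷ degf)
    with affine-on-hyperplane f degf | monomial-degree≤1 e Σe≤1
  ... | c , f≡c | inj₁ e≡1 = (λ i → a * proj₁ w⁻¹ + c i) , λ x Σx≡w → begin
    a * monomial e x + evalPoly f x     ≡⟨ cong₂ _+_ (trans (cong (a *_) (e≡1 x)) (ℚₚ.*-identityʳ a)) (f≡c x Σx≡w) ⟩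
    a + linear c x                      ≡⟨ cong (_+ linear c x) (a≡ x Σx≡w) ⟨
    linear (λ _ → a * y) x + linear c x ≡⟨ linear-+ (λ _ → a * y) c x ⟨
    linear (λ i → a * y + c i) x        ∎
    where
    open ≡-Reasoning
    y = proj₁ w⁻¹
    a≡ : ∀ x → Σℚ x ≡ w → linear (λ _ → a * y) x ≡ a
    a≡ x Σx≡w = begin
      linear (λ _ → a * y) x ≡⟨ linear-constant (a * y) x ⟩
      a * y * Σℚ x           ≡⟨ cong (a * y *_) Σx≡w ⟩
      a * y * w              ≡⟨ ℚₚ.*-assoc a y w ⟩
      a * (y * w)            ≡⟨ cong (a *_) (proj₂ w⁻¹) ⟩
      a * 1ℚ                 ≡⟨ ℚₚ.*-identityʳ a ⟩
      a                      ∎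
  ... | c , f≡c | inj₂ (j , e≡xⱼ) = (λ i → single j a i + c i) , λ x Σx≡w → begin
    a * monomial e x + evalPoly f x       ≡⟨ cong₂ _+_ (cong (a *_) (e≡xⱼ x)) (f≡c x Σx≡w) ⟩
    a * x j + linear c x                  ≡⟨ cong (_+ linear c x) (linear-single j a x) ⟨
    linear (single j a) x + linear c x    ≡⟨ linear-+ (single j a) c x ⟨
    linear (λ i → single j a i + c i) x   ∎
    where open ≡-Reasoning

  coordinates-basis : (Ω : Pt r → Set) → (∀ x → Ω x → Σℚ x ≡ w) →
                      (∀ c → (∀ x → Ω x → linear c x ≡ 0ℚ) → ∀ i → c i ≡ 0ℚ) →
                      IsBasisP r 1 Ω r coordinate
  coordinates-basis Ω Ω⊆hyperplane independent =
      (λ j → ℕₚ.≤-reflexive (Σℕ-δ j) All.∷ All.[])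
    , (λ c c≡0 → independent c (λ x x∈Ω → trans (sym (evalPoly-coordinates c x)) (c≡0 x x∈Ω)))
    , λ f degf → let (c , f≡c) = affine-on-hyperplane f degf in
        c , λ x x∈Ω → trans (f≡c x (Ω⊆hyperplane x x∈Ω)) (sym (evalPoly-coordinates c x))

RowsIndep⇒HasRank : ∀ {d} {C : Set} (M : Fin d → C → ℚ) → RowsIndep M → HasRank M d
RowsIndep⇒HasRank M independent =
    (id , id , independent)
  , λ σ σ-injective _ → let (i , j , i<j , σi≡σj) = Finₚ.pigeonhole (ℕₚ.n<1+n _) σ in
                        Finₚ.<-irrefl (σ-injective σi≡σj) i<j

-- Designs

record Design (m w : ℕ) : Set where
  field
    A B               : Fin (suc m) → Subset (suc m)
    weight-A          : ∀ i → ∣ A i ∣ ≡ w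
    weight-B          : ∀ i → ∣ B i ∣ ≡ w
    head-A₀           : head (A zero) ≡ outside
    head-B₀           : head (B zero) ≡ outside
    disjoint          : ∀ i j → A i ≢ B j
    balanced          : ∀ s → ∣ s ∣ ≤ 2 → count (λ i → s ⊆ᵇ A i) ≡ count (λ i → s ⊆ᵇ B i)
    affinely-spanning : ∀ c l → (∀ i → c · A i ≡ l) → (∀ i → c · B i ≡ l) → ∀ j → c j ≡ c zero

module _ {m k} (D : Design m (suc k)) where
  open Design D

  private
    Ω = BinarySphere (suc m) (suc k)

  vanishing⇒zero : ∀ c → (∀ i → c · A i ≡ 0ℚ) → (∀ i → c · B i ≡ 0ℚ) → ∀ j → c j ≡ 0ℚ
  vanishing⇒zero c onA onB j = trans (c≡c₀ j) (invertible⇒*≡0⇒≡0 (ℕ→ℚ-suc-invertible k) w*c₀≡0)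
    where
    open ≡-Reasoning
    c≡c₀ = affinely-spanning c 0ℚ onA onB
    w*c₀≡0 : ℕ→ℚ (suc k) * c zero ≡ 0ℚ
    w*c₀≡0 = begin
      ℕ→ℚ (suc k) * c zero    ≡⟨ cong (λ n → ℕ→ℚ n * c zero) (weight-A zero) ⟨
      ℕ→ℚ ∣ A zero ∣ * c zero ≡⟨ ·-constant c≡c₀ (A zero) ⟨
      c · A zero              ≡⟨ onA zero ⟩
      0ℚ                      ∎

  on-sphere : ∀ (X : Fin (suc m) → Subset (suc m)) → (∀ i → ∣ X i ∣ ≡ suc k) → ∀ i → Ω (point (X i))
  on-sphere X weight i = subst (λ w → BinarySphere (suc m) w (point (X i))) (weight i) (point∈BinarySphere (X i))

  moments : ∀ e → Σℕ e ≤ 2 → Σℚ (λ i → monomial e (point (A i))) ≡ Σℚ (λ i → monomial e (point (B i)))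
  moments e Σe≤2 = begin
    Σℚ (λ i → monomial e (point (A i)))    ≡⟨ Σℚ-cong (λ i → monomial-point e (A i)) ⟩
    Σℚ (λ i → bitℚ (support e ⊆ᵇ A i))     ≡⟨ Σℚ-bitℚ (λ i → support e ⊆ᵇ A i) ⟩
    ℕ→ℚ (count (λ i → support e ⊆ᵇ A i))   ≡⟨ cong ℕ→ℚ (balanced (support e) (ℕₚ.≤-trans (∣support∣≤Σℕ e) Σe≤2)) ⟩
    ℕ→ℚ (count (λ i → support e ⊆ᵇ B i))   ≡⟨ Σℚ-bitℚ (λ i → support e ⊆ᵇ B i) ⟨
    Σℚ (λ i → bitℚ (support e ⊆ᵇ B i))     ≡⟨ Σℚ-cong (λ i → monomial-point e (B i)) ⟨
    Σℚ (λ i → monomial e (point (B i)))    ∎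
    where open ≡-Reasoning

  tight-solution : IsTightPTE (suc m) 1 Ω (suc m) (point ∘ A) (point ∘ B)
  tight-solution =
      on-sphere A weight-A , on-sphere B weight-B
    , ((λ i j Aᵢ≡Bⱼ → disjoint i j (point-injective Aᵢ≡Bⱼ)) , λ e _ → moments e)
    , (suc m , coordinate , basis , refl , RowsIndep⇒HasRank (NANB coordinate (point ∘ A) (point ∘ B)) rows-independent)
    where
    at-point : ∀ c v → Σℚ (λ i → c i * evalPoly (coordinate i) (point v)) ≡ c · v
    at-point c v = trans (evalPoly-coordinates c (point v)) (linear-point c v)
    basis : IsBasisP (suc m) 1 Ω (suc m) coordinate
    basis = coordinates-basis (ℕ→ℚ-suc-invertible k) Ω (λ x → BinarySphere⇒Σℚ {w = suc k} x) λ c c≡0 →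
      vanishing⇒zero c (λ i → trans (sym (linear-point c (A i))) (c≡0 _ (on-sphere A weight-A i)))
                       (λ i → trans (sym (linear-point c (B i))) (c≡0 _ (on-sphere B weight-B i)))
    rows-independent : RowsIndep (NANB coordinate (point ∘ A) (point ∘ B))
    rows-independent c c≡0 = vanishing⇒zero c (λ i → trans (sym (at-point c (A i))) (c≡0 (inj₁ i)))
                                               (λ i → trans (sym (at-point c (B i))) (c≡0 (inj₂ i)))

-- The Paley design

rotate : ∀ {n} → Subset (suc n) → Subset (suc n)
rotate v = last v ∷ init v

translates : Subset 7 → Fin 7 → Subset 7
translates v = lookup (iterate rotate v 7)

residues nonresidues : Subset 7
residues    = outside ∷ inside  ∷ inside  ∷ outside ∷ inside  ∷ outside ∷ outside ∷ []
nonresidues = outside ∷ outside ∷ outside ∷ inside  ∷ outside ∷ inside  ∷ inside  ∷ []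

paley : Design 6 3
paley = record
  { A                 = A
  ; B                 = B
  ; weight-A          = from-yes (Finₚ.all? λ i → ∣ A i ∣ ℕ.≟ 3)
  ; weight-B          = from-yes (Finₚ.all? λ i → ∣ B i ∣ ℕ.≟ 3)
  ; head-A₀           = refl
  ; head-B₀           = refl
  ; disjoint          = from-yes (Finₚ.all? λ i → Finₚ.all? λ j → ¬? (Vecₚ.≡-dec Boolₚ._≟_ (A i) (B j)))
  ; balanced          = from-yes (all-subsets? λ s →
                          (∣ s ∣ ℕ.≤? 2) →-dec (count (λ i → s ⊆ᵇ A i) ℕ.≟ count (λ i → s ⊆ᵇ B i)))
  ; affinely-spanning = spanning
  }
  where
  A B : Fin 7 → Subset 7
  A = translates residues
  B = translates nonresidues
  spanning : ∀ c l → (∀ i → c · A i ≡ l) → (∀ i → c · B i ≡ l) → ∀ j → c j ≡ c zero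
  spanning c l onA onB j = sym (c₀≡ j)
    where
    row : Fin 7 ⊎ Fin 7 → Subset 7
    row = [ A , B ]
    on-row : ∀ x → c · row x ≡ l
    on-row = [ onA , onB ]
    exchange : ∀ x y {j} → row x ∪ ⁅ zero ⁆ ≡ row y ∪ ⁅ j ⁆ → row x ∩ ⁅ zero ⁆ ≡ row y ∩ ⁅ j ⁆ → c zero ≡ c j
    exchange x y ∪≡ ∩≡ = ·-exchange c ∪≡ ∩≡ (trans (on-row x) (sym (on-row y)))
    c₀≡ : ∀ j → c zero ≡ c j
    c₀≡ 0F = refl
    c₀≡ 1F = exchange (inj₂ 3F) (inj₁ 5F) refl refl
    c₀≡ 2F = exchange (inj₂ 6F) (inj₁ 3F) refl refl
    c₀≡ 3F = exchange (inj₁ 2F) (inj₂ 1F) refl refl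
    c₀≡ 4F = exchange (inj₂ 5F) (inj₁ 6F) refl refl
    c₀≡ 5F = exchange (inj₁ 1F) (inj₂ 4F) refl refl
    c₀≡ 6F = exchange (inj₁ 4F) (inj₂ 2F) refl refl

-- The extension step

pattern old i = suc (suc (suc (suc (suc i))))

oldTag : Subset 4
oldTag = ⁅ 0F ⁆ ∪ ⁅ 1F ⁆

tag : ∀ {m} → Fin (5 ℕ.+ m) → Subset 4
tag 0F      = ⁅ 2F ⁆ ∪ ⁅ 3F ⁆
tag 1F      = ⁅ 0F ⁆
tag 2F      = ⁅ 1F ⁆
tag 3F      = ⁅ 2F ⁆
tag 4F      = ⁅ 3F ⁆
tag (old _) = oldTag

body : ∀ {m} → Subset m → Subset m → (Fin m → Subset (suc m)) → Fin (5 ℕ.+ m) → Subset (suc m)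
body a b rest 0F      = outside ∷ a
body a b rest 1F      = inside ∷ a
body a b rest 2F      = inside ∷ a
body a b rest 3F      = inside ∷ b
body a b rest 4F      = inside ∷ b
body a b rest (old i) = rest i

extendRows : ∀ {m} → Subset m → Subset m → (Fin m → Subset (suc m)) → Fin (5 ℕ.+ m) → Subset (4 ℕ.+ suc m)
extendRows a b rest i = tag i ++ body a b rest i

∣extendRows∣ : ∀ {m w} {a b : Subset m} {rest} → ∣ a ∣ ≡ w → ∣ b ∣ ≡ w → (∀ i → ∣ rest i ∣ ≡ w) →
               ∀ i → ∣ extendRows a b rest i ∣ ≡ 2 ℕ.+ w
∣extendRows∣ ∣a∣ ∣b∣ ∣rest∣ 0F      = cong (2 ℕ.+_) ∣a∣
∣extendRows∣ ∣a∣ ∣b∣ ∣rest∣ 1F      = cong (2 ℕ.+_) ∣a∣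
∣extendRows∣ ∣a∣ ∣b∣ ∣rest∣ 2F      = cong (2 ℕ.+_) ∣a∣
∣extendRows∣ ∣a∣ ∣b∣ ∣rest∣ 3F      = cong (2 ℕ.+_) ∣b∣
∣extendRows∣ ∣a∣ ∣b∣ ∣rest∣ 4F      = cong (2 ℕ.+_) ∣b∣
∣extendRows∣ ∣a∣ ∣b∣ ∣rest∣ (old i) = cong (2 ℕ.+_) (∣rest∣ i)

extendRows-disjoint : ∀ {m} {a b : Subset m} {rest rest' : Fin m → Subset (suc m)} →
                      a ≢ b → (∀ i j → rest i ≢ rest' j) → ∀ i j → extendRows a b rest i ≢ extendRows b a rest' j
extendRows-disjoint a≢b rest≢rest' 0F 0F           = ++⁺-≢ {4} (⁅ 2F ⁆ ∪ ⁅ 3F ⁆) (a≢b ∘ Vecₚ.∷-injectiveʳ)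
extendRows-disjoint a≢b rest≢rest' 0F 1F           = λ ()
extendRows-disjoint a≢b rest≢rest' 0F 2F           = λ ()
extendRows-disjoint a≢b rest≢rest' 0F 3F           = λ ()
extendRows-disjoint a≢b rest≢rest' 0F 4F           = λ ()
extendRows-disjoint a≢b rest≢rest' 0F (old j)      = λ ()
extendRows-disjoint a≢b rest≢rest' 1F 0F           = λ ()
extendRows-disjoint a≢b rest≢rest' 1F 1F           = ++⁺-≢ {4} ⁅ 0F ⁆ (a≢b ∘ Vecₚ.∷-injectiveʳ)
extendRows-disjoint a≢b rest≢rest' 1F 2F           = λ ()
extendRows-disjoint a≢b rest≢rest' 1F 3F           = λ ()
extendRows-disjoint a≢b rest≢rest' 1F 4F           = λ ()
extendRows-disjoint a≢b rest≢rest' 1F (old j)      = λ ()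
extendRows-disjoint a≢b rest≢rest' 2F 0F           = λ ()
extendRows-disjoint a≢b rest≢rest' 2F 1F           = λ ()
extendRows-disjoint a≢b rest≢rest' 2F 2F           = ++⁺-≢ {4} ⁅ 1F ⁆ (a≢b ∘ Vecₚ.∷-injectiveʳ)
extendRows-disjoint a≢b rest≢rest' 2F 3F           = λ ()
extendRows-disjoint a≢b rest≢rest' 2F 4F           = λ ()
extendRows-disjoint a≢b rest≢rest' 2F (old j)      = λ ()
extendRows-disjoint a≢b rest≢rest' 3F 0F           = λ ()
extendRows-disjoint a≢b rest≢rest' 3F 1F           = λ ()
extendRows-disjoint a≢b rest≢rest' 3F 2F           = λ ()
extendRows-disjoint a≢b rest≢rest' 3F 3F           = ++⁺-≢ {4} ⁅ 2F ⁆ (a≢b ∘ sym ∘ Vecₚ.∷-injectiveʳ)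
extendRows-disjoint a≢b rest≢rest' 3F 4F           = λ ()
extendRows-disjoint a≢b rest≢rest' 3F (old j)      = λ ()
extendRows-disjoint a≢b rest≢rest' 4F 0F           = λ ()
extendRows-disjoint a≢b rest≢rest' 4F 1F           = λ ()
extendRows-disjoint a≢b rest≢rest' 4F 2F           = λ ()
extendRows-disjoint a≢b rest≢rest' 4F 3F           = λ ()
extendRows-disjoint a≢b rest≢rest' 4F 4F           = ++⁺-≢ {4} ⁅ 3F ⁆ (a≢b ∘ sym ∘ Vecₚ.∷-injectiveʳ)
extendRows-disjoint a≢b rest≢rest' 4F (old j)      = λ ()
extendRows-disjoint a≢b rest≢rest' (old i) 0F      = λ ()
extendRows-disjoint a≢b rest≢rest' (old i) 1F      = λ ()
extendRows-disjoint a≢b rest≢rest' (old i) 2F      = λ ()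
extendRows-disjoint a≢b rest≢rest' (old i) 3F      = λ ()
extendRows-disjoint a≢b rest≢rest' (old i) 4F      = λ ()
extendRows-disjoint a≢b rest≢rest' (old i) (old j) = ++⁺-≢ {4} oldTag (rest≢rest' i j)

newRows : Subset 4 → Bool → Bool → Bool → ℕ
newRows t sp M₁ M₂ =
  bitℕ ((t ⊆ᵇ (⁅ 2F ⁆ ∪ ⁅ 3F ⁆)) ∧ (not sp ∧ M₁)) ℕ.+ (bitℕ ((t ⊆ᵇ ⁅ 0F ⁆) ∧ M₁) ℕ.+
    (bitℕ ((t ⊆ᵇ ⁅ 1F ⁆) ∧ M₁) ℕ.+ (bitℕ ((t ⊆ᵇ ⁅ 2F ⁆) ∧ M₂) ℕ.+ bitℕ ((t ⊆ᵇ ⁅ 3F ⁆) ∧ M₂))))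

count-extendRows : ∀ {m} (t : Subset 4) sp (s : Subset m) a b rest →
  count (λ i → (t ++ sp ∷ s) ⊆ᵇ extendRows a b rest i)
  ≡ newRows t sp (s ⊆ᵇ a) (s ⊆ᵇ b) ℕ.+ bitℕ (t ⊆ᵇ oldTag) ℕ.* count (λ i → (sp ∷ s) ⊆ᵇ rest i)
count-extendRows t sp s a b rest = begin
  count (λ i → (t ++ sp ∷ s) ⊆ᵇ extendRows a b rest i)
    ≡⟨ count-cong (λ i → ⊆ᵇ-++ t (sp ∷ s) (tag i) (body a b rest i)) ⟩
  count (λ i → (t ⊆ᵇ tag i) ∧ ((sp ∷ s) ⊆ᵇ body a b rest i))
    ≡⟨ cong (λ n → r₀ ℕ.+ (r₁ ℕ.+ (r₂ ℕ.+ (r₃ ℕ.+ (r₄ ℕ.+ n)))))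
            (count-∧ (t ⊆ᵇ oldTag) (λ i → (sp ∷ s) ⊆ᵇ rest i)) ⟩
  r₀ ℕ.+ (r₁ ℕ.+ (r₂ ℕ.+ (r₃ ℕ.+ (r₄ ℕ.+ old-rows))))
    ≡⟨ assoc r₀ r₁ r₂ r₃ r₄ old-rows ⟩
  r₀ ℕ.+ (r₁ ℕ.+ (r₂ ℕ.+ (r₃ ℕ.+ r₄))) ℕ.+ old-rows ∎
  where
  open ≡-Reasoning
  old-rows = bitℕ (t ⊆ᵇ oldTag) ℕ.* count (λ i → (sp ∷ s) ⊆ᵇ rest i)
  r₀ = bitℕ ((t ⊆ᵇ (⁅ 2F ⁆ ∪ ⁅ 3F ⁆)) ∧ (not sp ∧ (s ⊆ᵇ a)))
  r₁ = bitℕ ((t ⊆ᵇ ⁅ 0F ⁆) ∧ (s ⊆ᵇ a))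
  r₂ = bitℕ ((t ⊆ᵇ ⁅ 1F ⁆) ∧ (s ⊆ᵇ a))
  r₃ = bitℕ ((t ⊆ᵇ ⁅ 2F ⁆) ∧ (s ⊆ᵇ b))
  r₄ = bitℕ ((t ⊆ᵇ ⁅ 3F ⁆) ∧ (s ⊆ᵇ b))
  assoc : ∀ x₀ x₁ x₂ x₃ x₄ y →
          x₀ ℕ.+ (x₁ ℕ.+ (x₂ ℕ.+ (x₃ ℕ.+ (x₄ ℕ.+ y)))) ≡ x₀ ℕ.+ (x₁ ℕ.+ (x₂ ℕ.+ (x₃ ℕ.+ x₄))) ℕ.+ y
  assoc = solve-∀

-- Write g = bitℕ (t ⊆ᵇ oldTag) and α, β for the shares bitℕ (not sp ∧ M₁), bitℕ (not sp ∧ M₂) of the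
-- first old rows.  The count over extendRows a b rest plus g (α + β) is newRows⁺ t sp M₁ M₂ plus g
-- times the old count, so the new counts agree as soon as newRows⁺ is symmetric in M₁ and M₂.
newRows⁺ : Subset 4 → Bool → Bool → Bool → ℕ
newRows⁺ t sp M₁ M₂ = newRows t sp M₁ M₂ ℕ.+ bitℕ (t ⊆ᵇ oldTag) ℕ.* bitℕ (not sp ∧ M₂)

newRows⁺-symmetric : ∀ t sp M₁ M₂ → ∣ t ∣ ℕ.+ (bitℕ sp ℕ.+ bitℕ (M₁ xor M₂)) ≤ 2 →
                     newRows⁺ t sp M₁ M₂ ≡ newRows⁺ t sp M₂ M₁
newRows⁺-symmetric = from-yes (all-subsets? λ t → all-bools? λ sp → all-bools? λ M₁ → all-bools? λ M₂ →
  (∣ t ∣ ℕ.+ (bitℕ sp ℕ.+ bitℕ (M₁ xor M₂)) ℕ.≤? 2) →-dec (newRows⁺ t sp M₁ M₂ ℕ.≟ newRows⁺ t sp M₂ M₁))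

module Extension {m w} (D : Design m w) where
  open Design D

  a₀ b₀ : Subset m
  a₀ = tail (A zero)
  b₀ = tail (B zero)

  A₀≡ : A zero ≡ outside ∷ a₀
  A₀≡ = ≡outside∷tail (A zero) head-A₀

  B₀≡ : B zero ≡ outside ∷ b₀
  B₀≡ = ≡outside∷tail (B zero) head-B₀

  A' B' : Fin (5 ℕ.+ m) → Subset (4 ℕ.+ suc m)
  A' = extendRows a₀ b₀ (A ∘ suc)
  B' = extendRows b₀ a₀ (B ∘ suc)

  ∣a₀∣ : ∣ a₀ ∣ ≡ w
  ∣a₀∣ = trans (sym (cong ∣_∣ A₀≡)) (weight-A zero)

  ∣b₀∣ : ∣ b₀ ∣ ≡ w
  ∣b₀∣ = trans (sym (cong ∣_∣ B₀≡)) (weight-B zero)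

  a₀≢b₀ : a₀ ≢ b₀
  a₀≢b₀ a₀≡b₀ = disjoint zero zero (trans A₀≡ (trans (cong (outside ∷_) a₀≡b₀) (sym B₀≡)))

  balanced' : ∀ s → ∣ s ∣ ≤ 2 → count (λ i → s ⊆ᵇ A' i) ≡ count (λ i → s ⊆ᵇ B' i)
  balanced' (t₀ ∷ t₁ ∷ t₂ ∷ t₃ ∷ sp ∷ s) ∣ts∣≤2 = begin
    count (λ i → (t ++ sp ∷ s) ⊆ᵇ A' i)
      ≡⟨ count-extendRows t sp s a₀ b₀ (A ∘ suc) ⟩
    newRows t sp M₁ M₂ ℕ.+ g ℕ.* count (λ i → (sp ∷ s) ⊆ᵇ A (suc i))
      ≡⟨ gated-balance _ _ g _ _ _ _ (newRows⁺-symmetric t sp M₁ M₂ new-bound) old-balance ⟩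
    newRows t sp M₂ M₁ ℕ.+ g ℕ.* count (λ i → (sp ∷ s) ⊆ᵇ B (suc i))
      ≡⟨ count-extendRows t sp s b₀ a₀ (B ∘ suc) ⟨
    count (λ i → (t ++ sp ∷ s) ⊆ᵇ B' i) ∎
    where
    open ≡-Reasoning
    t  = t₀ ∷ t₁ ∷ t₂ ∷ t₃ ∷ []
    M₁ = s ⊆ᵇ a₀
    M₂ = s ⊆ᵇ b₀
    g  = bitℕ (t ⊆ᵇ oldTag)
    ∣ts∣≡ : ∣ t ++ sp ∷ s ∣ ≡ ∣ t ∣ ℕ.+ (bitℕ sp ℕ.+ ∣ s ∣)
    ∣ts∣≡ = trans (∣++∣ t (sp ∷ s)) (cong (∣ t ∣ ℕ.+_) (∣∷∣ sp s))
    new-bound : ∣ t ∣ ℕ.+ (bitℕ sp ℕ.+ bitℕ (M₁ xor M₂)) ≤ 2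
    new-bound = ℕₚ.≤-trans (ℕₚ.+-monoʳ-≤ ∣ t ∣ (ℕₚ.+-monoʳ-≤ (bitℕ sp) (⊆ᵇ-xor≤ s a₀ b₀)))
                           (ℕₚ.≤-trans (ℕₚ.≤-reflexive (sym ∣ts∣≡)) ∣ts∣≤2)
    old-bound : ∣ sp ∷ s ∣ ≤ 2
    old-bound = ℕₚ.≤-trans (ℕₚ.m≤n+m ∣ sp ∷ s ∣ ∣ t ∣)
                           (ℕₚ.≤-trans (ℕₚ.≤-reflexive (sym (∣++∣ t (sp ∷ s)))) ∣ts∣≤2)
    Rₐ R_b : ℕ
    Rₐ  = count (λ i → (sp ∷ s) ⊆ᵇ A (suc i))
    R_b = count (λ i → (sp ∷ s) ⊆ᵇ B (suc i))
    old-balance : bitℕ (not sp ∧ M₁) ℕ.+ Rₐ ≡ bitℕ (not sp ∧ M₂) ℕ.+ R_b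
    old-balance = begin
      bitℕ ((sp ∷ s) ⊆ᵇ (outside ∷ a₀)) ℕ.+ Rₐ   ≡⟨ cong (λ X → bitℕ ((sp ∷ s) ⊆ᵇ X) ℕ.+ Rₐ) A₀≡ ⟨
      count (λ i → (sp ∷ s) ⊆ᵇ A i)             ≡⟨ balanced (sp ∷ s) old-bound ⟩
      count (λ i → (sp ∷ s) ⊆ᵇ B i)             ≡⟨ cong (λ X → bitℕ ((sp ∷ s) ⊆ᵇ X) ℕ.+ R_b) B₀≡ ⟩
      bitℕ ((sp ∷ s) ⊆ᵇ (outside ∷ b₀)) ℕ.+ R_b  ∎

  spanning' : ∀ c l → (∀ i → c · A' i ≡ l) → (∀ i → c · B' i ≡ l) → ∀ j → c j ≡ c zero
  spanning' c l onA' onB' = all≡c₀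
    where
    c' : Fin (suc m) → ℚ
    c' j = c (suc (suc (suc (suc j))))
    c₁≡c₀ : c 1F ≡ c 0F
    c₁≡c₀ = ·-exchange c {A' 1F} {A' 2F} refl refl (trans (onA' 1F) (sym (onA' 2F)))
    c₂≡c₀ : c 2F ≡ c 0F
    c₂≡c₀ = ·-exchange c {A' 1F} {B' 3F} refl refl (trans (onA' 1F) (sym (onB' 3F)))
    c₃≡c₂ : c 3F ≡ c 2F
    c₃≡c₂ = ·-exchange c {A' 3F} {A' 4F} refl refl (trans (onA' 3F) (sym (onA' 4F)))
    c₄≡c₃ : c 4F ≡ c 3F
    c₄≡c₃ = ·-exchange c {A' 0F} {B' 3F} refl refl (trans (onA' 0F) (sym (onB' 3F)))
    L = (c' ∘ suc) · a₀
    on-A'₀ : c 2F + (c 3F + L) ≡ l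
    on-A'₀ = onA' 0F
    on-old : ∀ X → c 0F + (c 1F + c' · X) ≡ l → c' · X ≡ L
    on-old X onX = cancel-prefix onX on-A'₀ (sym c₂≡c₀) (trans c₁≡c₀ (sym (trans c₃≡c₂ c₂≡c₀)))
    onA : ∀ i → c' · A i ≡ L
    onA zero    = cong (c' ·_) A₀≡
    onA (suc i) = on-old (A (suc i)) (onA' (old i))
    onB : ∀ i → c' · B i ≡ L
    onB zero    = trans (cong (c' ·_) B₀≡) (cancel-prefix {c 2F} {c 3F} (onB' 0F) on-A'₀ refl refl)
    onB (suc i) = on-old (B (suc i)) (onB' (old i))
    all≡c₀ : ∀ j → c j ≡ c zero
    all≡c₀ 0F                        = refl
    all≡c₀ 1F                        = c₁≡c₀
    all≡c₀ 2F                        = c₂≡c₀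
    all≡c₀ 3F                        = trans c₃≡c₂ c₂≡c₀
    all≡c₀ (suc (suc (suc (suc j)))) = trans (affinely-spanning c' L onA onB j) (trans c₄≡c₃ (trans c₃≡c₂ c₂≡c₀))

  extended : Design (4 ℕ.+ m) (2 ℕ.+ w)
  extended = record
    { A                 = A'
    ; B                 = B'
    ; weight-A          = ∣extendRows∣ ∣a₀∣ ∣b₀∣ (weight-A ∘ suc)
    ; weight-B          = ∣extendRows∣ ∣b₀∣ ∣a₀∣ (weight-B ∘ suc)
    ; head-A₀           = refl
    ; head-B₀           = refl
    ; disjoint          = extendRows-disjoint a₀≢b₀ (λ i j → disjoint (suc i) (suc j))
    ; balanced          = balanced'
    ; affinely-spanning = spanning'
    }

design : ∀ q → Design (6 ℕ.+ q ℕ.* 4) (3 ℕ.+ q ℕ.* 2)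
design zero    = paley
design (suc q) = Extension.extended (design q)

≡3-mod-4 : ∀ p → p % 4 ≡ 3 → 7 ≤ p → ∃ λ q → p ≡ 7 ℕ.+ q ℕ.* 4
≡3-mod-4 p p%4≡3 7≤p with p / 4 | trans (m≡m%n+[m/n]*n p 4) (cong (ℕ._+ (p / 4) ℕ.* 4) p%4≡3)
... | zero  | p≡3     = ⊥-elim (from-no (7 ℕ.≤? 3) (subst (7 ≤_) p≡3 7≤p))
... | suc q | p≡7+q*4 = q , p≡7+q*4

half : ∀ q → (6 ℕ.+ q ℕ.* 4) / 2 ≡ 3 ℕ.+ q ℕ.* 2
half q = trans (cong (_/ 2) (double q)) (m*n/n≡m (3 ℕ.+ q ℕ.* 2) 2)
  where
  double : ∀ q → 6 ℕ.+ q ℕ.* 4 ≡ (3 ℕ.+ q ℕ.* 2) ℕ.* 2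
  double = solve-∀

theorem3p6 : (p : ℕ) → Prime p → p % 4 ≡ 3 → 7 ≤ p →
    ∃[ n ] Σ (Fin n → Pt p) λ A → Σ (Fin n → Pt p) λ B →
      IsTightPTE p 1 (BinarySphere p ((p ∸ 1) / 2)) n A B
theorem3p6 p _ p%4≡3 7≤p with ≡3-mod-4 p p%4≡3 7≤p
... | q , refl rewrite half q = _ , point ∘ A , point ∘ B , tight-solution (design q)
  where open Design (design q)
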